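{- Let $G$ be a connected graph with $n$ vertices, $m$ edges and diameter $d$, and let $0<\alpha<1$. Then \[ \alpha^{d}\, n(n-1)+2m\alpha(1-\alpha^{d-1})\;\le\; GC(G)\;\le\;\alpha^{2} n(n-1)+2m\alpha(1-\alpha), \] \[ \frac{n(n-1)}{2^{d}}+m(1-0.5^{d-1})\;\le\; C(G)\;\le\;\frac{n(n-1)+2m}{4}, \] and in each formula equality holds (in both inequalities) if the diameter $d$ is at most $2$.
   Context: All graphs are finite and simple. For vertices $i,j$ of a connected graph $G$, $d(i,j)$ denotes the distance between $i$ and $j$; the diameter of $G$ is $\max_{i,j} d(i,j)$. The closeness of $G$ is $C(G)=\sum_{i\in V(G)}\sum_{j\neq i} 2^{ -d(i,j)}$. For a fixed real number $0<\alpha<1$, the generalized closeness is $GC(G)=\sum_{i\in V(G)}\sum_{j\neq i}\alpha^{d(i,j)}$.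
   Formalization: The parameter α is a rational number with $0<\alpha<1$ instead of a real one. -}

module Defs where

open import Data.Nat as ℕ using (ℕ; zero; suc; _<ᵇ_)
open import Data.Nat.Properties using ()
open import Data.Bool using (Bool; true; false; _∧_; if_then_else_)
open import Data.Fin using (Fin; toℕ; _≟_)
open import Data.List using (List; map; foldr; concatMap; allFin)
open import Data.Product using (_×_)
open import Data.Integer using (+_)
open import Data.Rational using (ℚ; 0ℚ; 1ℚ; _+_; _*_; _/_)
open import Relation.Nullary using (yes; no)
open import Relation.Binary.PropositionalEquality using (_≡_)

record SimpleGraph (n : ℕ) : Set where
  field
    adj     : Fin n → Fin n → Bool
    adj-sym : ∀ i j → adj i j ≡ adj j i
    irrefl  : ∀ i → adj i i ≡ false
open SimpleGraph public

data Walk {n : ℕ} (G : SimpleGraph n) : Fin n → Fin n → ℕ → Set where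
  here : ∀ {i} → Walk G i i 0
  step : ∀ {i j k l} → adj G i j ≡ true → Walk G j k l → Walk G i k (suc l)

-- δ is the distance function of G: δ i j is the length of a shortest walk
-- (equivalently path) from i to j.  Existence of such δ forces connectivity.
IsDistance : {n : ℕ} → SimpleGraph n → (Fin n → Fin n → ℕ) → Set
IsDistance G δ = ∀ i j → Walk G i j (δ i j) × (∀ k → Walk G i j k → δ i j ℕ.≤ k)

Connected : {n : ℕ} → SimpleGraph n → Set
Connected {n} G = ∀ (i j : Fin n) → Data.Product.∃ λ k → Walk G i j k
  where import Data.Product

sumℕ : List ℕ → ℕ
sumℕ = foldr ℕ._+_ 0

maxℕ : List ℕ → ℕ
maxℕ = foldr ℕ._⊔_ 0

sumℚ : List ℚ → ℚ
sumℚ = foldr _+_ 0ℚ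

pairs : (n : ℕ) → List (Fin n × Fin n)
pairs n = concatMap (λ i → map (λ j → i Data.Product., j) (allFin n)) (allFin n)
  where import Data.Product

edges : {n : ℕ} → SimpleGraph n → ℕ
edges {n} G = sumℕ (map (λ p → if (toℕ (proj₁ p) <ᵇ toℕ (proj₂ p)) ∧ adj G (proj₁ p) (proj₂ p)
                               then 1 else 0) (pairs n))
  where open Data.Product using (proj₁; proj₂)

diameter : {n : ℕ} → (Fin n → Fin n → ℕ) → ℕ
diameter {n} δ = maxℕ (map (λ p → δ (proj₁ p) (proj₂ p)) (pairs n))
  where open Data.Product using (proj₁; proj₂)

infixr 8 _^_
_^_ : ℚ → ℕ → ℚ
x ^ zero  = 1ℚ
x ^ suc k = x * (x ^ k)

ℕtoℚ : ℕ → ℚ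
ℕtoℚ k = + k / 1

genCloseness : {n : ℕ} → (Fin n → Fin n → ℕ) → ℚ → ℚ
genCloseness {n} δ α = sumℚ (map term (pairs n))
  where
    open Data.Product using (_,_)
    term : Fin n × Fin n → ℚ
    term (i , j) with i ≟ j
    ... | yes _ = 0ℚ
    ... | no  _ = α ^ δ i j

closeness : {n : ℕ} → (Fin n → Fin n → ℕ) → ℚ
closeness {n} δ = sumℚ (map term (pairs n))
  where
    open Data.Product using (_,_)
    term : Fin n × Fin n → ℚ
    term (i , j) with i ≟ j
    ... | yes _ = 0ℚ
    ... | no  _ = (+ 1 / 2) ^ δ i j

-- Among the ordered pairs of distinct vertices, the 2m adjacent ones each contribute exactly α.
-- Every other pair lies at a distance between 2 and d, so its term α^dist lies between α^d and α^2.
-- Summing these pairwise bounds gives both inequalities. When d ≤ 2, every distinct non-adjacent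
-- pair is at distance exactly 2 = d, so each pairwise bound is an equality. The closeness C is the
-- case α = 1/2.
module Submission where

open import Defs
open import Data.Nat as ℕ using (ℕ; _∸_)
open import Data.Fin using (Fin)
open import Data.Product using (_×_)
open import Data.Integer using (+_)
open import Data.Rational using (ℚ; 0ℚ; 1ℚ; ½; _+_; _*_; _-_; _/_; _<_; _≤_)
open import Relation.Binary.PropositionalEquality using (_≡_)

open import Data.Bool using (Bool; true; false; not; _∧_; if_then_else_)
open import Data.Fin using (zero; suc; toℕ; _≟_)
open import Data.Fin.Properties using (toℕ-injective)
open import Data.Integer as ℤ using ()
open import Data.Integer.Properties as ℤₚ using ()
open import Data.List using (List; []; _∷_; _++_; map; concatMap; tabulate; allFin)
open import Data.List.Membership.Propositional using (_∈_)
open import Data.List.Membership.Propositional.Properties using (∈-map⁺; ∈-concatMap⁺; ∈-allFin)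
open import Data.List.Properties using (map-++; map-∘; map-cong)
open import Data.List.Relation.Unary.Any as Any using (here; there)
open import Data.Nat.Coprimality as Coprime using (1-coprimeTo)
open import Data.Nat.ListAction.Properties using (sum-++)
open import Data.Nat.Properties as ℕₚ
  using (+-0-commutativeMonoid; <⇒≯; ≮⇒≥; <ᵇ-reflects-<; m≤m⊔n; m≤n⊔m)
open import Algebra.Properties.CommutativeMonoid.Sum +-0-commutativeMonoid
  using (sum-syntax; sum-cong-≗; ∑-distrib-+; ∑-comm)
open import Data.Product using (_,_; proj₁; proj₂)
open import Data.Sum using (_⊎_; inj₁; inj₂)
open import Data.Rational using (mkℚ; _≥_; nonNegative)
open import Data.Rational.Properties as ℚ
  using (≤-refl; <⇒≤; +-mono-≤; *-monoˡ-≤-nonNeg; *-identityʳ; /-cong; normalize-coprime)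
open import Data.Rational.Solver using (module +-*-Solver)
open import Relation.Binary.Core using (Rel)
open import Relation.Binary.Definitions using (Reflexive)
open import Relation.Binary.PropositionalEquality
  using (refl; sym; trans; cong; cong₂; subst; subst₂; _≢_; _≗_; module ≡-Reasoning)
open import Relation.Nullary using (does; yes; no; contradiction)
open import Relation.Nullary.Decidable using (dec-true; dec-false; toWitness)
open import Relation.Nullary.Reflects using (ofʸ; ofⁿ)
open +-*-Solver

∑-const : ∀ n c → ∑[ i < n ] c ≡ n ℕ.* c
∑-const ℕ.zero    c = refl
∑-const (ℕ.suc n) c = cong (c ℕ.+_) (∑-const n c)

sumℕ-tabulate : ∀ {A : Set} {n} (f : A → ℕ) (g : Fin n → A) →
  sumℕ (map f (tabulate g)) ≡ ∑[ i < n ] f (g i)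
sumℕ-tabulate {n = ℕ.zero}  f g = refl
sumℕ-tabulate {n = ℕ.suc n} f g = cong (f (g zero) ℕ.+_) (sumℕ-tabulate f (λ i → g (suc i)))

sumℕ-map-concatMap : ∀ {A B : Set} (f : B → ℕ) (g : A → List B) (xs : List A) →
  sumℕ (map f (concatMap g xs)) ≡ sumℕ (map (λ x → sumℕ (map f (g x))) xs)
sumℕ-map-concatMap f g [] = refl
sumℕ-map-concatMap f g (x ∷ xs) = begin
  sumℕ (map f (g x ++ concatMap g xs))                   ≡⟨ cong sumℕ (map-++ f (g x) _) ⟩
  sumℕ (map f (g x) ++ map f (concatMap g xs))           ≡⟨ sum-++ (map f (g x)) _ ⟩
  sumℕ (map f (g x)) ℕ.+ sumℕ (map f (concatMap g xs))   ≡⟨ cong (_ ℕ.+_) (sumℕ-map-concatMap f g xs) ⟩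
  sumℕ (map (λ x → sumℕ (map f (g x))) (x ∷ xs))         ∎
  where open ≡-Reasoning

sumℕ-pairs : ∀ {n} (f : Fin n × Fin n → ℕ) →
  sumℕ (map f (pairs n)) ≡ ∑[ i < n ] ∑[ j < n ] f (i , j)
sumℕ-pairs {n} f = begin
  sumℕ (map f (pairs n))
    ≡⟨ sumℕ-map-concatMap f row (allFin n) ⟩
  sumℕ (map (λ i → sumℕ (map f (row i))) (allFin n))
    ≡⟨ sumℕ-tabulate (λ i → sumℕ (map f (row i))) (λ i → i) ⟩
  ∑[ i < n ] sumℕ (map f (row i))
    ≡⟨ sum-cong-≗ (λ i → trans (cong sumℕ (sym (map-∘ (allFin n))))
                                (sumℕ-tabulate (λ j → f (i , j)) (λ j → j))) ⟩
  ∑[ i < n ] ∑[ j < n ] f (i , j)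
    ∎
  where
  open ≡-Reasoning
  row : Fin n → List (Fin n × Fin n)
  row i = map (i ,_) (allFin n)

∈-pairs : ∀ {n} (i j : Fin n) → (i , j) ∈ pairs n
∈-pairs {n} i j = ∈-concatMap⁺ (λ k → map (k ,_) (allFin n))
  (Any.map (λ { refl → ∈-map⁺ (i ,_) (∈-allFin j) }) (∈-allFin i))

∈⇒≤maxℕ : ∀ {x xs} → x ∈ xs → x ℕ.≤ maxℕ xs
∈⇒≤maxℕ {xs = y ∷ ys} (here refl)  = m≤m⊔n y (maxℕ ys)
∈⇒≤maxℕ {xs = y ∷ ys} (there x∈ys) = ℕₚ.≤-trans (∈⇒≤maxℕ x∈ys) (m≤n⊔m y (maxℕ ys))

ℕtoℚ-mkℚ : ∀ a → ℕtoℚ a ≡ mkℚ (+ a) 0 (Coprime.sym (1-coprimeTo a))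
ℕtoℚ-mkℚ a = normalize-coprime (Coprime.sym (1-coprimeTo a))

ℕtoℚ-homo-+ : ∀ a b → ℕtoℚ (a ℕ.+ b) ≡ ℕtoℚ a + ℕtoℚ b
ℕtoℚ-homo-+ a b = begin
  + (a ℕ.+ b) / 1
    ≡⟨ /-cong (sym (cong₂ ℤ._+_ (ℤₚ.*-identityʳ (+ a)) (ℤₚ.*-identityʳ (+ b)))) refl ⟩
  (+ a ℤ.* + 1 ℤ.+ + b ℤ.* + 1) / 1
    ≡⟨ sym (cong₂ _+_ (ℕtoℚ-mkℚ a) (ℕtoℚ-mkℚ b)) ⟩
  ℕtoℚ a + ℕtoℚ b
    ∎
  where open ≡-Reasoning

ℕtoℚ-homo-sumℕ : ∀ {A : Set} (f : A → ℕ) xs →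
  ℕtoℚ (sumℕ (map f xs)) ≡ sumℚ (map (λ x → ℕtoℚ (f x)) xs)
ℕtoℚ-homo-sumℕ f [] = refl
ℕtoℚ-homo-sumℕ f (x ∷ xs) =
  trans (ℕtoℚ-homo-+ (f x) _) (cong (_+_ (ℕtoℚ (f x))) (ℕtoℚ-homo-sumℕ f xs))

sumℚ-mono : ∀ {A : Set} {f g : A → ℚ} → (∀ x → f x ≤ g x) → ∀ xs →
  sumℚ (map f xs) ≤ sumℚ (map g xs)
sumℚ-mono f≤g []       = ≤-refl
sumℚ-mono f≤g (x ∷ xs) = +-mono-≤ (f≤g x) (sumℚ-mono f≤g xs)

sumℚ-linear : ∀ {A : Set} a b (f g : A → ℚ) xs →
  sumℚ (map (λ x → a * f x + b * g x) xs) ≡ a * sumℚ (map f xs) + b * sumℚ (map g xs)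
sumℚ-linear a b f g [] = solve 2 (λ a b → con 0ℚ := a :* con 0ℚ :+ b :* con 0ℚ) refl a b
sumℚ-linear a b f g (x ∷ xs) = trans (cong (_+_ (a * f x + b * g x)) (sumℚ-linear a b f g xs))
  (solve 6 (λ a b u v s t → a :* u :+ b :* v :+ (a :* s :+ b :* t) := a :* (u :+ s) :+ b :* (v :+ t))
         refl a b (f x) (g x) (sumℚ (map f xs)) (sumℚ (map g xs)))

module _ {β : ℚ} (0≤β : 0ℚ ≤ β) (β≤1 : β ≤ 1ℚ) where

  ^≤1 : ∀ k → β ^ k ≤ 1ℚ
  ^≤1 ℕ.zero    = ≤-refl
  ^≤1 (ℕ.suc k) = begin
    β * β ^ k  ≤⟨ *-monoˡ-≤-nonNeg β {{nonNegative 0≤β}} (^≤1 k) ⟩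
    β * 1ℚ     ≡⟨ *-identityʳ β ⟩
    β          ≤⟨ β≤1 ⟩
    1ℚ         ∎
    where open ℚ.≤-Reasoning

  ^-antitone : ∀ {k l} → k ℕ.≤ l → β ^ l ≤ β ^ k
  ^-antitone {l = l} ℕ.z≤n = ^≤1 l
  ^-antitone (ℕ.s≤s k≤l)  = *-monoˡ-≤-nonNeg β {{nonNegative 0≤β}} (^-antitone k≤l)

^-split : ∀ β {k} → 1 ℕ.≤ k → β ^ k + β * (1ℚ - β ^ (k ∸ 1)) ≡ β
^-split β {ℕ.suc k} _ = solve 2 (λ b y → b :* y :+ b :* (con 1ℚ :- y) := b) refl β (β ^ k)

^2-split : ∀ β → β ^ 2 + β * (1ℚ - β) ≡ β
^2-split = solve 1 (λ b → b :* (b :* con 1ℚ) :+ b :* (con 1ℚ :- b) := b) refl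

indicator : Bool → ℕ
indicator b = if b then 1 else 0

indicator-split : ∀ x y b → (x ≡ y → b ≡ false) →
  indicator b ≡ indicator ((x ℕ.<ᵇ y) ∧ b) ℕ.+ indicator ((y ℕ.<ᵇ x) ∧ b)
indicator-split x y b x≡y⇒¬b
  with x ℕ.<ᵇ y | <ᵇ-reflects-< x y | y ℕ.<ᵇ x | <ᵇ-reflects-< y x
... | true  | ofʸ x<y  | true  | ofʸ y<x  = contradiction y<x (<⇒≯ x<y)
... | true  | _        | false | _        = sym (ℕₚ.+-identityʳ _)
... | false | _        | true  | _        = refl
... | false | ofⁿ x≮y | false | ofⁿ y≮x
  rewrite x≡y⇒¬b (ℕₚ.≤-antisym (≮⇒≥ y≮x) (≮⇒≥ x≮y)) = refl

distinct : ∀ {n} → Fin n × Fin n → ℕ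
distinct (i , j) = indicator (not (does (i ≟ j)))

∑-distinct-row : ∀ {n} (i : Fin n) → ∑[ j < n ] distinct (i , j) ≡ n ∸ 1
∑-distinct-row {ℕ.suc n}         zero    = trans (∑-const n 1) (ℕₚ.*-identityʳ n)
∑-distinct-row {ℕ.suc (ℕ.suc n)} (suc i) = cong ℕ.suc (∑-distinct-row i)

sum-distinct : ∀ n → sumℕ (map distinct (pairs n)) ≡ n ℕ.* (n ∸ 1)
sum-distinct n = begin
  sumℕ (map distinct (pairs n))           ≡⟨ sumℕ-pairs (distinct {n}) ⟩
  ∑[ i < n ] ∑[ j < n ] distinct (i , j)  ≡⟨ sum-cong-≗ (∑-distinct-row {n}) ⟩
  ∑[ i < n ] (n ∸ 1)                      ≡⟨ ∑-const n (n ∸ 1) ⟩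
  n ℕ.* (n ∸ 1)                           ∎
  where open ≡-Reasoning

module _ {n : ℕ} (G : SimpleGraph n) where

  adj⇒≢ : ∀ {i j} → adj G i j ≡ true → i ≢ j
  adj⇒≢ {i} i∼j refl = contradiction (trans (sym i∼j) (irrefl G i)) λ ()

  pair-trichotomy : ∀ i j → i ≡ j ⊎ adj G i j ≡ true ⊎ (i ≢ j × adj G i j ≡ false)
  pair-trichotomy i j with i ≟ j | adj G i j
  ... | yes i≡j | _     = inj₁ i≡j
  ... | no i≢j  | true  = inj₂ (inj₁ refl)
  ... | no i≢j  | false = inj₂ (inj₂ (i≢j , refl))

  adjacent forwardEdge : Fin n × Fin n → ℕ
  adjacent (i , j)    = indicator (adj G i j)
  forwardEdge (i , j) = indicator ((toℕ i ℕ.<ᵇ toℕ j) ∧ adj G i j)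

  adjacent-split : ∀ i j → adjacent (i , j) ≡ forwardEdge (i , j) ℕ.+ forwardEdge (j , i)
  adjacent-split i j = begin
    indicator (adj G i j)
      ≡⟨ indicator-split (toℕ i) (toℕ j) (adj G i j) loopless ⟩
    forwardEdge (i , j) ℕ.+ indicator ((toℕ j ℕ.<ᵇ toℕ i) ∧ adj G i j)
      ≡⟨ cong (λ b → forwardEdge (i , j) ℕ.+ indicator ((toℕ j ℕ.<ᵇ toℕ i) ∧ b)) (adj-sym G i j) ⟩
    forwardEdge (i , j) ℕ.+ forwardEdge (j , i)
      ∎
    where
    open ≡-Reasoning
    loopless : toℕ i ≡ toℕ j → adj G i j ≡ false
    loopless eq rewrite toℕ-injective eq = irrefl G j

  sum-adjacent : sumℕ (map adjacent (pairs n)) ≡ edges G ℕ.+ edges G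
  sum-adjacent = begin
    sumℕ (map adjacent (pairs n))
      ≡⟨ sumℕ-pairs adjacent ⟩
    ∑[ i < n ] ∑[ j < n ] adjacent (i , j)
      ≡⟨ sum-cong-≗ (λ i → sum-cong-≗ (adjacent-split i)) ⟩
    ∑[ i < n ] ∑[ j < n ] (forwardEdge (i , j) ℕ.+ forwardEdge (j , i))
      ≡⟨ sum-cong-≗ (λ i → ∑-distrib-+ (λ j → forwardEdge (i , j)) (λ j → forwardEdge (j , i))) ⟩
    ∑[ i < n ] (∑[ j < n ] forwardEdge (i , j) ℕ.+ ∑[ j < n ] forwardEdge (j , i))
      ≡⟨ ∑-distrib-+ (λ i → ∑[ j < n ] forwardEdge (i , j)) (λ i → ∑[ j < n ] forwardEdge (j , i)) ⟩
    ∑[ i < n ] ∑[ j < n ] forwardEdge (i , j) ℕ.+ ∑[ i < n ] ∑[ j < n ] forwardEdge (j , i)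
      ≡⟨ cong (∑[ i < n ] ∑[ j < n ] forwardEdge (i , j) ℕ.+_) (∑-comm (λ i j → forwardEdge (j , i))) ⟩
    ∑[ i < n ] ∑[ j < n ] forwardEdge (i , j) ℕ.+ ∑[ j < n ] ∑[ i < n ] forwardEdge (j , i)
      ≡⟨ sym (cong₂ ℕ._+_ (sumℕ-pairs forwardEdge) (sumℕ-pairs forwardEdge)) ⟩
    edges G ℕ.+ edges G
      ∎
    where open ≡-Reasoning

  affineWeight : ℚ → ℚ → Fin n × Fin n → ℚ
  affineWeight a b x = a * ℕtoℚ (distinct x) + b * ℕtoℚ (adjacent x)

  affineWeight-diag : ∀ a b i → affineWeight a b (i , i) ≡ 0ℚ
  affineWeight-diag a b i rewrite dec-true (i ≟ i) refl | irrefl G i =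
    solve 2 (λ a b → a :* con 0ℚ :+ b :* con 0ℚ := con 0ℚ) refl a b

  affineWeight-adjacent : ∀ a b {i j} → adj G i j ≡ true → affineWeight a b (i , j) ≡ a + b
  affineWeight-adjacent a b {i} {j} i∼j rewrite dec-false (i ≟ j) (adj⇒≢ i∼j) | i∼j =
    solve 2 (λ a b → a :* con 1ℚ :+ b :* con 1ℚ := a :+ b) refl a b

  affineWeight-far : ∀ a b {i j} → i ≢ j → adj G i j ≡ false → affineWeight a b (i , j) ≡ a
  affineWeight-far a b {i} {j} i≢j i≁j rewrite dec-false (i ≟ j) i≢j | i≁j =
    solve 2 (λ a b → a :* con 1ℚ :+ b :* con 0ℚ := a) refl a b

  sum-affineWeight : ∀ a b →
    sumℚ (map (affineWeight a b) (pairs n))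
      ≡ a * ℕtoℚ (n ℕ.* (n ∸ 1)) + b * (ℕtoℚ (edges G) + ℕtoℚ (edges G))
  sum-affineWeight a b = begin
    sumℚ (map (affineWeight a b) (pairs n))
      ≡⟨ sumℚ-linear a b (λ x → ℕtoℚ (distinct x)) (λ x → ℕtoℚ (adjacent x)) (pairs n) ⟩
    a * sumℚ (map (λ x → ℕtoℚ (distinct x)) (pairs n)) + b * sumℚ (map (λ x → ℕtoℚ (adjacent x)) (pairs n))
      ≡⟨ sym (cong₂ (λ u v → a * u + b * v) (ℕtoℚ-homo-sumℕ distinct (pairs n))
                                            (ℕtoℚ-homo-sumℕ adjacent (pairs n))) ⟩
    a * ℕtoℚ (sumℕ (map distinct (pairs n))) + b * ℕtoℚ (sumℕ (map adjacent (pairs n)))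
      ≡⟨ cong₂ (λ u v → a * u + b * v) (cong ℕtoℚ (sum-distinct n))
                                       (trans (cong ℕtoℚ sum-adjacent) (ℕtoℚ-homo-+ (edges G) (edges G))) ⟩
    a * ℕtoℚ (n ℕ.* (n ∸ 1)) + b * (ℕtoℚ (edges G) + ℕtoℚ (edges G))
      ∎
    where open ≡-Reasoning

distance≤diameter : ∀ {n} (δ : Fin n → Fin n → ℕ) i j → δ i j ℕ.≤ diameter δ
distance≤diameter δ i j = ∈⇒≤maxℕ (∈-map⁺ (λ p → δ (proj₁ p) (proj₂ p)) (∈-pairs i j))

weight : ∀ {n} → (Fin n → Fin n → ℕ) → ℚ → Fin n × Fin n → ℚ
weight δ β (i , j) = if does (i ≟ j) then 0ℚ else β ^ δ i j

weight-diag : ∀ {n} (δ : Fin n → Fin n → ℕ) β i → weight δ β (i , i) ≡ 0ℚ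
weight-diag δ β i rewrite dec-true (i ≟ i) refl = refl

weight-distinct : ∀ {n} (δ : Fin n → Fin n → ℕ) β {i j} → i ≢ j → weight δ β (i , j) ≡ β ^ δ i j
weight-distinct δ β {i} {j} i≢j rewrite dec-false (i ≟ j) i≢j = refl

Sandwich Tight : ℚ → ℚ → ℚ → Set
Sandwich l s u = l ≤ s × s ≤ u
Tight    l s u = l ≡ s × s ≡ u

module _ {n : ℕ} {G : SimpleGraph n} {δ : Fin n → Fin n → ℕ} (isDist : IsDistance G δ) where

  private
    d : ℕ
    d = diameter δ

  distance-adjacent : ∀ {i j} → adj G i j ≡ true → δ i j ≡ 1
  distance-adjacent {i} {j} i∼j with δ i j | isDist i j
  ... | ℕ.zero          | here , _     = contradiction refl (adj⇒≢ G i∼j)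
  ... | ℕ.suc ℕ.zero    | _            = refl
  ... | ℕ.suc (ℕ.suc _) | _ , shortest with shortest 1 (step i∼j here)
  ...   | ℕ.s≤s ()

  distance-far : ∀ {i j} → i ≢ j → adj G i j ≡ false → 2 ℕ.≤ δ i j
  distance-far {i} {j} i≢j i≁j with δ i j | isDist i j
  ... | ℕ.zero          | here , _          = contradiction refl i≢j
  ... | ℕ.suc ℕ.zero    | step i∼j here , _ = contradiction (trans (sym i∼j) i≁j) λ ()
  ... | ℕ.suc (ℕ.suc _) | _                 = ℕ.s≤s (ℕ.s≤s ℕ.z≤n)

  module _ (d≤2 : d ℕ.≤ 2) {i j : Fin n} (i≢j : i ≢ j) (i≁j : adj G i j ≡ false) where

    far-distance≡2 : δ i j ≡ 2
    far-distance≡2 = ℕₚ.≤-antisym (ℕₚ.≤-trans (distance≤diameter δ i j) d≤2) (distance-far i≢j i≁j)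

    far-diameter≡2 : d ≡ 2
    far-diameter≡2 = ℕₚ.≤-antisym d≤2 (ℕₚ.≤-trans (distance-far i≢j i≁j) (distance≤diameter δ i j))

  weight-adjacent : ∀ β {i j} → adj G i j ≡ true → weight δ β (i , j) ≡ β
  weight-adjacent β {i} {j} i∼j = begin
    weight δ β (i , j)  ≡⟨ weight-distinct δ β (adj⇒≢ G i∼j) ⟩
    β ^ δ i j           ≡⟨ cong (β ^_) (distance-adjacent i∼j) ⟩
    β * 1ℚ              ≡⟨ *-identityʳ β ⟩
    β                   ∎
    where open ≡-Reasoning

  affineWeight-∼-weight : ∀ {ℓ} (_∼_ : Rel ℚ ℓ) → Reflexive _∼_ → ∀ {β} a b →
    (∀ {i j} → adj G i j ≡ true → a + b ≡ β) →
    (∀ {i j} → i ≢ j → adj G i j ≡ false → a ∼ (β ^ δ i j)) →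
    ∀ x → affineWeight G a b x ∼ weight δ β x
  affineWeight-∼-weight _∼_ refl∼ {β} a b onEdge onFar (i , j) with pair-trichotomy G i j
  ... | inj₁ refl =
    subst₂ _∼_ (sym (affineWeight-diag G a b i)) (sym (weight-diag δ β i)) refl∼
  ... | inj₂ (inj₁ i∼j) =
    subst₂ _∼_ (sym (trans (affineWeight-adjacent G a b i∼j) (onEdge i∼j)))
               (sym (weight-adjacent β i∼j)) refl∼
  ... | inj₂ (inj₂ (i≢j , i≁j)) =
    subst₂ _∼_ (sym (affineWeight-far G a b i≢j i≁j)) (sym (weight-distinct δ β i≢j)) (onFar i≢j i≁j)

  lowerWeight upperWeight : ℚ → Fin n × Fin n → ℚ
  lowerWeight β = affineWeight G (β ^ d) (β * (1ℚ - β ^ (d ∸ 1)))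
  upperWeight β = affineWeight G (β ^ 2) (β * (1ℚ - β))

  lowerWeight-adjacent : ∀ β {i j} → adj G i j ≡ true → β ^ d + β * (1ℚ - β ^ (d ∸ 1)) ≡ β
  lowerWeight-adjacent β {i} {j} i∼j =
    ^-split β (subst (ℕ._≤ d) (distance-adjacent i∼j) (distance≤diameter δ i j))

  lowerWeight≤weight : ∀ {β} → 0ℚ ≤ β → β ≤ 1ℚ → ∀ x → lowerWeight β x ≤ weight δ β x
  lowerWeight≤weight {β} 0≤β β≤1 = affineWeight-∼-weight _≤_ ≤-refl _ _ (lowerWeight-adjacent β)
    (λ {i} {j} _ _ → ^-antitone 0≤β β≤1 (distance≤diameter δ i j))

  weight≤upperWeight : ∀ {β} → 0ℚ ≤ β → β ≤ 1ℚ → ∀ x → weight δ β x ≤ upperWeight β x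
  weight≤upperWeight {β} 0≤β β≤1 = affineWeight-∼-weight _≥_ ≤-refl _ _ (λ _ → ^2-split β)
    (λ i≢j i≁j → ^-antitone 0≤β β≤1 (distance-far i≢j i≁j))

  lowerWeight≡weight : d ℕ.≤ 2 → ∀ β x → lowerWeight β x ≡ weight δ β x
  lowerWeight≡weight d≤2 β = affineWeight-∼-weight _≡_ refl _ _ (lowerWeight-adjacent β)
    (λ i≢j i≁j → cong (β ^_) (trans (far-diameter≡2 d≤2 i≢j i≁j) (sym (far-distance≡2 d≤2 i≢j i≁j))))

  upperWeight≡weight : d ℕ.≤ 2 → ∀ β x → upperWeight β x ≡ weight δ β x
  upperWeight≡weight d≤2 β = affineWeight-∼-weight _≡_ refl _ _ (λ _ → ^2-split β)
    (λ i≢j i≁j → cong (β ^_) (sym (far-distance≡2 d≤2 i≢j i≁j)))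

  weightSum-bounds : ∀ {β} → 0ℚ ≤ β → β ≤ 1ℚ →
    let N = ℕtoℚ (n ℕ.* (n ∸ 1))
        M = ℕtoℚ (edges G)
        L = β ^ d * N + β * (1ℚ - β ^ (d ∸ 1)) * (M + M)
        U = β ^ 2 * N + β * (1ℚ - β) * (M + M)
        S = sumℚ (map (weight δ β) (pairs n))
    in Sandwich L S U × (d ℕ.≤ 2 → Tight L S U)
  weightSum-bounds {β} 0≤β β≤1 =
    ( subst (_≤ S) lowerSum (sumℚ-mono (lowerWeight≤weight 0≤β β≤1) (pairs n))
    , subst (S ≤_) upperSum (sumℚ-mono (weight≤upperWeight 0≤β β≤1) (pairs n)) )
    , λ d≤2 →
      trans (sym lowerSum) (cong sumℚ (map-cong (lowerWeight≡weight d≤2 β) (pairs n)))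
    , trans (cong sumℚ (map-cong (λ x → sym (upperWeight≡weight d≤2 β x)) (pairs n))) upperSum
    where
    N M S : ℚ
    N = ℕtoℚ (n ℕ.* (n ∸ 1))
    M = ℕtoℚ (edges G)
    S = sumℚ (map (weight δ β) (pairs n))
    lowerSum : sumℚ (map (lowerWeight β) (pairs n)) ≡ β ^ d * N + β * (1ℚ - β ^ (d ∸ 1)) * (M + M)
    lowerSum = sum-affineWeight G (β ^ d) (β * (1ℚ - β ^ (d ∸ 1)))
    upperSum : sumℚ (map (upperWeight β) (pairs n)) ≡ β ^ 2 * N + β * (1ℚ - β) * (M + M)
    upperSum = sum-affineWeight G (β ^ 2) (β * (1ℚ - β))

-- genCloseness and closeness sum a summand that Defs defines by `with` in a where block, so it
-- cannot be named here; summandOf recovers it from their definitional unfolding.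
summandOf : ∀ {A : Set} (s : ℚ) (xs : List A) {t : A → ℚ} → s ≡ sumℚ (map t xs) → A → ℚ
summandOf _ _ {t} _ = t

genCloseness≡weightSum : ∀ {n} (δ : Fin n → Fin n → ℕ) α →
  genCloseness δ α ≡ sumℚ (map (weight δ α) (pairs n))
genCloseness≡weightSum {n} δ α = cong sumℚ (map-cong summand≗weight (pairs n))
  where
  summand≗weight : summandOf (genCloseness δ α) (pairs n) refl ≗ weight δ α
  summand≗weight (i , j) with i ≟ j
  ... | yes _ = refl
  ... | no _  = refl

closeness≡weightSum : ∀ {n} (δ : Fin n → Fin n → ℕ) →
  closeness δ ≡ sumℚ (map (weight δ ½) (pairs n))
closeness≡weightSum {n} δ = cong sumℚ (map-cong summand≗weight (pairs n))
  where
  summand≗weight : summandOf (closeness δ) (pairs n) refl ≗ weight δ ½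
  summand≗weight (i , j) with i ≟ j
  ... | yes _ = refl
  ... | no _  = refl

sandwich-cong : ∀ {P : Set} {l s u l′ s′ u′} → l ≡ l′ → s ≡ s′ → u ≡ u′ →
  Sandwich l s u × (P → Tight l s u) → Sandwich l′ s′ u′ × (P → Tight l′ s′ u′)
sandwich-cong refl refl refl bounds = bounds

genClosenessBound-form : ∀ p a y N M →
  p * N + a * (1ℚ - y) * (M + M) ≡ p * N + ℕtoℚ 2 * M * a * (1ℚ - y)
genClosenessBound-form = solve 5 (λ p a y N M →
  p :* N :+ a :* (con 1ℚ :- y) :* (M :+ M) := p :* N :+ con (ℕtoℚ 2) :* M :* a :* (con 1ℚ :- y)) refl

closenessLowerBound-form : ∀ p y N M → p * N + ½ * (1ℚ - y) * (M + M) ≡ N * p + M * (1ℚ - y)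
closenessLowerBound-form = solve 4 (λ p y N M →
  p :* N :+ con ½ :* (con 1ℚ :- y) :* (M :+ M) := N :* p :+ M :* (con 1ℚ :- y)) refl

closenessUpperBound-form : ∀ N M →
  ½ ^ 2 * N + ½ * (1ℚ - ½) * (M + M) ≡ (N + ℕtoℚ 2 * M) * (+ 1 / 4)
closenessUpperBound-form = solve 2 (λ N M →
  con (½ ^ 2) :* N :+ con ½ :* (con 1ℚ :- con ½) :* (M :+ M) := (N :+ con (ℕtoℚ 2) :* M) :* con (+ 1 / 4))
  refl

0≤½ : 0ℚ ≤ ½
0≤½ = toWitness {a? = 0ℚ ℚ.≤? ½} _

½≤1 : ½ ≤ 1ℚ
½≤1 = toWitness {a? = ½ ℚ.≤? 1ℚ} _

theorem3p2 : ∀ (n : ℕ) (G : SimpleGraph n) → Connected G →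
    ∀ (δ : Fin n → Fin n → ℕ) → IsDistance G δ →
    ∀ (α : ℚ) → 0ℚ < α → α < 1ℚ →
      let m = edges G
          d = diameter δ
          N = ℕtoℚ (n ℕ.* (n ∸ 1))
          M = ℕtoℚ m
          GCl = α ^ d * N + ℕtoℚ 2 * M * α * (1ℚ - α ^ (d ∸ 1))
          GCu = α ^ 2 * N + ℕtoℚ 2 * M * α * (1ℚ - α)
          Cl = N * (½ ^ d) + M * (1ℚ - ½ ^ (d ∸ 1))
          Cu = (N + ℕtoℚ 2 * M) * (+ 1 / 4)
      in (GCl ≤ genCloseness δ α × genCloseness δ α ≤ GCu)
       × (Cl ≤ closeness δ × closeness δ ≤ Cu)
       × (d ℕ.≤ 2 →
           (GCl ≡ genCloseness δ α × genCloseness δ α ≡ GCu)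
           × (Cl ≡ closeness δ × closeness δ ≡ Cu))
theorem3p2 n G _ δ isDist α 0<α α<1 =
  let gcBounds , gcTight =
        sandwich-cong (genClosenessBound-form (α ^ d) α (α ^ (d ∸ 1)) N M)
                      (sym (genCloseness≡weightSum δ α))
                      (genClosenessBound-form (α ^ 2) α α N M)
                      (weightSum-bounds isDist (<⇒≤ 0<α) (<⇒≤ α<1))
      cBounds , cTight =
        sandwich-cong (closenessLowerBound-form (½ ^ d) (½ ^ (d ∸ 1)) N M)
                      (sym (closeness≡weightSum δ))
                      (closenessUpperBound-form N M)
                      (weightSum-bounds isDist 0≤½ ½≤1)
  in gcBounds , cBounds , λ d≤2 → gcTight d≤2 , cTight d≤2
  where
  d : ℕ
  d = diameter δ
  N M : ℚ
  N = ℕtoℚ (n ℕ.* (n ∸ 1))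
  M = ℕtoℚ (edges G)
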